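{- Let $\overrightarrow{F}$ be the oriented graph on vertices $v_1,v_2,v_3,v_4$ with arcs $\overrightarrow{v_1v_2},\overrightarrow{v_2v_3},\overrightarrow{v_4v_3}$. Then for all sufficiently large $n$, $\mathrm{ex}_{\mathrm{ori}}(n,\overrightarrow{F})=\lfloor n^2/4\rfloor$.
   Context: An oriented graph is a directed graph with no loops, no multiple arcs and no pair of opposite arcs. $\mathrm{ex}_{\mathrm{ori}}(n,\overrightarrow{F})$ is the largest number of arcs in an $n$-vertex oriented graph not containing $\overrightarrow{F}$ as a (not necessarily induced) subgraph. -}

module Defs where

open import Data.Nat using (ℕ; _+_; _*_; _/_)
open import Data.Bool using (Bool; true; false)
open import Data.Fin using (Fin; zero; suc)
open import Data.List using (List; length; filter; cartesianProduct; allFin)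
open import Data.Product using (_×_; _,_; Σ)
open import Relation.Binary.PropositionalEquality using (_≡_; _≢_)
open import Relation.Nullary using (¬_)
open import Relation.Nullary.Decidable using (does)
open import Data.Bool.Properties using (_≟_)
open import Function.Definitions using (Injective)

-- A digraph on vertex set Fin n, given by its arc indicator:
-- arc u v ≡ true  means there is an arc u → v.  (Simple: at most one arc per ordered pair.)
Digraph : ℕ → Set
Digraph n = Fin n → Fin n → Bool

record IsOriented {n : ℕ} (G : Digraph n) : Set where
  field
    noLoop     : ∀ u → G u u ≡ false
    noOpposite : ∀ u v → G u v ≡ true → G v u ≡ false

arcCount : {n : ℕ} → Digraph n → ℕ
arcCount {n} G =
  length (filter (λ p → Data.Bool.Properties._≟_ (G (Data.Product.proj₁ p) (Data.Product.proj₂ p)) true)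
                 (cartesianProduct (allFin n) (allFin n)))

_⊆ᵍ_ : {m n : ℕ} → Digraph m → Digraph n → Set
_⊆ᵍ_ {m} {n} H G =
  Σ (Fin m → Fin n) λ φ → Injective _≡_ _≡_ φ × (∀ u v → H u v ≡ true → G (φ u) (φ v) ≡ true)

-- The oriented graph F on v1,v2,v3,v4 (indices 0,1,2,3) with arcs v1→v2, v2→v3, v4→v3.
F : Digraph 4
F zero (suc zero) = true
F (suc zero) (suc (suc zero)) = true
F (suc (suc (suc zero))) (suc (suc zero)) = true
F _ _ = false

quarterSq : ℕ → ℕ
quarterSq n = (n * n) / 4

ExOriIs : {m : ℕ} → ℕ → Digraph m → ℕ → Set
ExOriIs n H e =
  (Σ (Digraph n) λ G → IsOriented G × ¬ (H ⊆ᵍ G) × arcCount G ≡ e)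
  × (∀ (G : Digraph n) → IsOriented G → ¬ (H ⊆ᵍ G) → arcCount G Data.Nat.≤ e)

-- A copy of F is a path x → u → v plus a further arc w → v.  So once v is the end of a
-- directed path x → u → v, its in-neighbours lie in {x, u}; consequently a vertex of
-- in-degree at least 3 receives arcs only from sources.  With s sources, r vertices of
-- in-degree 1 or 2 and t of in-degree at least 3, there are at most 2r + ts ≤ (s + r + t)²/4
-- arcs as soon as s + r + t ≥ 8.  Conversely, orienting the balanced complete bipartite
-- graph from one side to the other creates no directed path of length 2, hence no F.

module Submission where

open import Defs
open import Data.Nat using (ℕ; _≥_)
open import Data.Product using (Σ)

import Algebra.Properties.Semiring.Sum as ∑
open import Data.Bool using (Bool; true; false; _∧_; not)
import Data.Bool.Properties as Bool
open import Data.Empty using (⊥; ⊥-elim)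
open import Data.Fin as Fin using (Fin; zero; suc; toℕ)
open import Data.Fin.Patterns using (0F; 1F; 2F; 3F)
open import Data.List using (List; length; filter; map; _++_; tabulate; cartesianProduct)
open import Data.List.Properties using (length-++; filter-++)
open import Data.Nat
  using (zero; suc; _+_; _*_; _≤_; _<_; z≤n; s≤s; z<s; _<ᵇ_; _/_; ⌊_/2⌋; ⌈_/2⌉; NonZero)
open import Data.Nat.DivMod using (m*n/n≡m; /-monoˡ-≤; +-distrib-/-∣ʳ)
open import Data.Nat.Divisibility using (n∣m*n)
open import Data.Nat.Properties
open import Data.Nat.Tactic.RingSolver using (solve-∀)
open import Data.Product using (∃; _×_; _,_; proj₁; proj₂)
open import Data.Sum as Sum using (_⊎_; inj₁; inj₂)
open import Data.Vec using (Vec; []; _∷_; lookup)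
open import Data.Vec.Relation.Unary.AllPairs using ([]; _∷_)
open import Data.Vec.Relation.Unary.All using ([]; _∷_)
open import Data.Vec.Relation.Unary.Unique.Propositional using (Unique)
open import Data.Vec.Relation.Unary.Unique.Propositional.Properties using (lookup-injective)
open import Function using (_∘_; id)
open import Relation.Binary.PropositionalEquality
open import Relation.Nullary using (¬_; Dec; yes; no; does)

open ∑ +-*-semiring
  using (sum-syntax; ∑-distrib-+; ∑-comm; sum-cong-≗; sum-replicate-zero; *-distribˡ-sum; *-distribʳ-sum)

⟦_⟧ : Bool → ℕ
⟦ true ⟧ = 1
⟦ false ⟧ = 0

⟦b⟧≤1 : ∀ b → ⟦ b ⟧ ≤ 1
⟦b⟧≤1 true = ≤-refl
⟦b⟧≤1 false = z≤n

0<⟦b⟧⇒b≡true : ∀ {b} → 0 < ⟦ b ⟧ → b ≡ true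
0<⟦b⟧⇒b≡true {true} _ = refl

⟦∧⟧≡* : ∀ a b → ⟦ a ∧ b ⟧ ≡ ⟦ a ⟧ * ⟦ b ⟧
⟦∧⟧≡* true b = sym (*-identityˡ ⟦ b ⟧)
⟦∧⟧≡* false b = refl

⟦b⟧+⟦not-b⟧≡1 : ∀ b → ⟦ b ⟧ + ⟦ not b ⟧ ≡ 1
⟦b⟧+⟦not-b⟧≡1 true = refl
⟦b⟧+⟦not-b⟧≡1 false = refl

∑-mono-≤ : ∀ {n} {f g : Fin n → ℕ} → (∀ i → f i ≤ g i) → ∑[ i < n ] f i ≤ ∑[ i < n ] g i
∑-mono-≤ {zero} f≤g = z≤n
∑-mono-≤ {suc n} f≤g = +-mono-≤ (f≤g zero) (∑-mono-≤ (f≤g ∘ suc))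

∑-1≡n : ∀ n → ∑[ i < n ] 1 ≡ n
∑-1≡n zero = refl
∑-1≡n (suc n) = cong suc (∑-1≡n n)

∑-positive : ∀ {n} (f : Fin n → ℕ) → 0 < ∑[ i < n ] f i → ∃ λ i → 0 < f i
∑-positive {suc n} f 0<∑f with f zero in eq
... | zero = let i , 0<fi = ∑-positive (f ∘ suc) 0<∑f in suc i , 0<fi
... | suc _ = zero , subst (0 <_) (sym eq) z<s

∑-⟦≟⟧≡1 : ∀ {n} (j : Fin n) → ∑[ i < n ] ⟦ does (i Fin.≟ j) ⟧ ≡ 1
∑-⟦≟⟧≡1 {suc n} zero = cong suc (sum-replicate-zero n)
∑-⟦≟⟧≡1 (suc j) = ∑-⟦≟⟧≡1 j

∑-⟦<ᵇ⟧≡k : ∀ {n k} → k ≤ n → ∑[ i < n ] ⟦ toℕ i <ᵇ k ⟧ ≡ k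
∑-⟦<ᵇ⟧≡k {zero} z≤n = refl
∑-⟦<ᵇ⟧≡k {suc n} {zero} z≤n = sum-replicate-zero (suc n)
∑-⟦<ᵇ⟧≡k (s≤s k≤n) = cong suc (∑-⟦<ᵇ⟧≡k k≤n)

∑⟦p⟧+∑⟦not-p⟧≡n : ∀ {n} (p : Fin n → Bool) →
                  ∑[ i < n ] ⟦ p i ⟧ + ∑[ i < n ] ⟦ not (p i) ⟧ ≡ n
∑⟦p⟧+∑⟦not-p⟧≡n {n} p = begin
  ∑[ i < n ] ⟦ p i ⟧ + ∑[ i < n ] ⟦ not (p i) ⟧ ≡⟨ ∑-distrib-+ (⟦_⟧ ∘ p) (⟦_⟧ ∘ not ∘ p) ⟨
  ∑[ i < n ] (⟦ p i ⟧ + ⟦ not (p i) ⟧)          ≡⟨ sum-cong-≗ (⟦b⟧+⟦not-b⟧≡1 ∘ p) ⟩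
  ∑[ i < n ] 1                                  ≡⟨ ∑-1≡n n ⟩
  n                                             ∎
  where open ≡-Reasoning

module _ {a b} {A : Set a} {B : Set b} (p : A → B → Bool) where

  private
    p? : ∀ x → Dec (p (proj₁ x) (proj₂ x) ≡ true)
    p? x = p (proj₁ x) (proj₂ x) Bool.≟ true

  length-filter-map-tabulate : ∀ {k} (x : A) (g : Fin k → B) →
    length (filter p? (map (x ,_) (tabulate g))) ≡ ∑[ j < k ] ⟦ p x (g j) ⟧
  length-filter-map-tabulate {zero} x g = refl
  length-filter-map-tabulate {suc k} x g with p x (g zero)
  ... | true = cong suc (length-filter-map-tabulate x (g ∘ suc))
  ... | false = length-filter-map-tabulate x (g ∘ suc)

  length-filter-cartesianProduct : ∀ {m k} (f : Fin m → A) (g : Fin k → B) →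
    length (filter p? (cartesianProduct (tabulate f) (tabulate g)))
      ≡ ∑[ i < m ] ∑[ j < k ] ⟦ p (f i) (g j) ⟧
  length-filter-cartesianProduct {zero} f g = refl
  length-filter-cartesianProduct {suc m} {k} f g = begin
    length (filter p? (row ++ rest))            ≡⟨ cong length (filter-++ p? row rest) ⟩
    length (filter p? row ++ filter p? rest)    ≡⟨ length-++ (filter p? row) ⟩
    length (filter p? row) + length (filter p? rest)
      ≡⟨ cong₂ _+_ (length-filter-map-tabulate (f zero) g) (length-filter-cartesianProduct (f ∘ suc) g) ⟩
    ∑[ i < suc m ] ∑[ j < k ] ⟦ p (f i) (g j) ⟧ ∎
    where
    open ≡-Reasoning
    row : List (A × B)
    row = map (f zero ,_) (tabulate g)
    rest : List (A × B)
    rest = cartesianProduct (tabulate (f ∘ suc)) (tabulate g)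

arcCount≡∑∑ : ∀ {n} (G : Digraph n) → arcCount G ≡ ∑[ u < n ] ∑[ v < n ] ⟦ G u v ⟧
arcCount≡∑∑ G = length-filter-cartesianProduct G id id

indeg : ∀ {n} → Digraph n → Fin n → ℕ
indeg {n} G v = ∑[ u < n ] ⟦ G u v ⟧

arcCount≡∑indeg : ∀ {n} (G : Digraph n) → arcCount G ≡ ∑[ v < n ] indeg G v
arcCount≡∑indeg G = trans (arcCount≡∑∑ G) (∑-comm (λ u v → ⟦ G u v ⟧))

module _ {n : ℕ} {G : Digraph n} (ori : IsOriented G) where
  open IsOriented ori

  private
    true≢false : true ≢ false
    true≢false ()

    arc⇒≢ : ∀ {u v} → G u v ≡ true → u ≢ v
    arc⇒≢ {u} uv refl = true≢false (trans (sym uv) (noLoop u))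

  path+arc⇒F⊆ᵍ : ∀ {x u v w} → G x u ≡ true → G u v ≡ true → G w v ≡ true →
                 w ≢ u → w ≢ x → F ⊆ᵍ G
  path+arc⇒F⊆ᵍ {x} {u} {v} {w} xu uv wv w≢u w≢x =
    lookup vertices , (λ {i} {j} → lookup-injective distinct i j) , arcs
    where
    vertices : Vec (Fin n) 4
    vertices = x ∷ u ∷ v ∷ w ∷ []
    x≢v : x ≢ v
    x≢v refl = true≢false (trans (sym xu) (noOpposite u x uv))
    distinct : Unique vertices
    distinct = (arc⇒≢ xu ∷ x≢v ∷ (w≢x ∘ sym) ∷ [])
             ∷ (arc⇒≢ uv ∷ (w≢u ∘ sym) ∷ [])
             ∷ ((arc⇒≢ wv ∘ sym) ∷ [])
             ∷ [] ∷ []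
    arcs : ∀ i j → F i j ≡ true → G (lookup vertices i) (lookup vertices j) ≡ true
    arcs 0F 1F _ = xu
    arcs 1F 2F _ = uv
    arcs 3F 2F _ = wv
    arcs 0F 0F ()
    arcs 0F (suc (suc _)) ()
    arcs 1F 0F ()
    arcs 1F 1F ()
    arcs 1F 3F ()
    arcs 2F _ ()
    arcs 3F 0F ()
    arcs 3F 1F ()
    arcs 3F 3F ()

[≡0] [1‥2] [≥3] : ℕ → ℕ
[≡0] zero = 1
[≡0] (suc _) = 0
[1‥2] 1 = 1
[1‥2] 2 = 1
[1‥2] _ = 0
[≥3] (suc (suc (suc _))) = 1
[≥3] _ = 0

[≡0]+[1‥2]+[≥3]≡1 : ∀ d → [≡0] d + [1‥2] d + [≥3] d ≡ 1
[≡0]+[1‥2]+[≥3]≡1 0 = refl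
[≡0]+[1‥2]+[≥3]≡1 1 = refl
[≡0]+[1‥2]+[≥3]≡1 2 = refl
[≡0]+[1‥2]+[≥3]≡1 (suc (suc (suc _))) = refl

module DegreeClasses {n : ℕ} (G : Digraph n) where

  sources middles highs : ℕ
  sources = ∑[ v < n ] [≡0] (indeg G v)
  middles = ∑[ v < n ] [1‥2] (indeg G v)
  highs = ∑[ v < n ] [≥3] (indeg G v)

  n≡sources+middles+highs : n ≡ sources + middles + highs
  n≡sources+middles+highs = begin
    n                                                   ≡⟨ ∑-1≡n n ⟨
    ∑[ v < n ] 1                                        ≡⟨ sum-cong-≗ ([≡0]+[1‥2]+[≥3]≡1 ∘ d) ⟨
    ∑[ v < n ] ([≡0] (d v) + [1‥2] (d v) + [≥3] (d v))  ≡⟨ ∑-distrib-+ _ ([≥3] ∘ d) ⟩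
    ∑[ v < n ] ([≡0] (d v) + [1‥2] (d v)) + highs
      ≡⟨ cong (_+ highs) (∑-distrib-+ ([≡0] ∘ d) ([1‥2] ∘ d)) ⟩
    sources + middles + highs                           ∎
    where
    open ≡-Reasoning
    d : Fin n → ℕ
    d = indeg G

module _ {n : ℕ} {G : Digraph n} (ori : IsOriented G) (F⊈G : ¬ F ⊆ᵍ G) where
  open DegreeClasses G

  path⇒indeg≤2 : ∀ {x u v} → G x u ≡ true → G u v ≡ true → indeg G v ≤ 2
  path⇒indeg≤2 {x} {u} {v} xu uv = begin
    indeg G v                                   ≤⟨ ∑-mono-≤ in-neighbour ⟩
    ∑[ w < n ] (⟦ w ≟u ⟧ + ⟦ w ≟x ⟧)            ≡⟨ ∑-distrib-+ (λ w → ⟦ w ≟u ⟧) (λ w → ⟦ w ≟x ⟧) ⟩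
    ∑[ w < n ] ⟦ w ≟u ⟧ + ∑[ w < n ] ⟦ w ≟x ⟧   ≡⟨ cong₂ _+_ (∑-⟦≟⟧≡1 u) (∑-⟦≟⟧≡1 x) ⟩
    2                                           ∎
    where
    open ≤-Reasoning
    _≟u _≟x : Fin n → Bool
    w ≟u = does (w Fin.≟ u)
    w ≟x = does (w Fin.≟ x)
    in-neighbour : ∀ w → ⟦ G w v ⟧ ≤ ⟦ w ≟u ⟧ + ⟦ w ≟x ⟧
    in-neighbour w with w Fin.≟ u | w Fin.≟ x | G w v in wv
    ... | yes _   | _       | b     = ≤-trans (⟦b⟧≤1 b) (m≤m+n 1 _)
    ... | no _    | yes _   | b     = ⟦b⟧≤1 b
    ... | no w≢u  | no w≢x  | true  = ⊥-elim (F⊈G (path+arc⇒F⊆ᵍ ori xu uv wv w≢u w≢x))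
    ... | no _    | no _    | false = z≤n

  2<indeg⇒in-neighbour-is-source : ∀ {u v} → 2 < indeg G v → G u v ≡ true → indeg G u ≡ 0
  2<indeg⇒in-neighbour-is-source {u} 2<dv uv with indeg G u ≟ 0
  ... | yes du≡0 = du≡0
  ... | no du≢0 =
    let x , 0<⟦xu⟧ = ∑-positive (λ x → ⟦ G x u ⟧) (n≢0⇒n>0 du≢0)
    in ⊥-elim (<⇒≱ 2<dv (path⇒indeg≤2 (0<⟦b⟧⇒b≡true 0<⟦xu⟧) uv))

  2<indeg⇒indeg≤sources : ∀ {v} → 2 < indeg G v → indeg G v ≤ sources
  2<indeg⇒indeg≤sources {v} 2<dv = ∑-mono-≤ in-neighbour-is-source
    where
    in-neighbour-is-source : ∀ u → ⟦ G u v ⟧ ≤ [≡0] (indeg G u)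
    in-neighbour-is-source u with G u v in uv
    ... | false = z≤n
    ... | true rewrite 2<indeg⇒in-neighbour-is-source 2<dv uv = ≤-refl

  indeg≤2*[1‥2]+[≥3]*sources : ∀ v → indeg G v ≤ 2 * [1‥2] (indeg G v) + [≥3] (indeg G v) * sources
  indeg≤2*[1‥2]+[≥3]*sources v with indeg G v in dv
  ... | 0 = z≤n
  ... | 1 = s≤s z≤n
  ... | 2 = ≤-refl
  ... | suc (suc (suc d)) =
    ≤-trans (subst (_≤ sources) dv (2<indeg⇒indeg≤sources 2<dv)) (m≤m+n sources 0)
    where
    2<dv : 2 < indeg G v
    2<dv = subst (2 <_) (sym dv) (s≤s (s≤s (s≤s z≤n)))

  arcCount≤2*middles+highs*sources : arcCount G ≤ 2 * middles + highs * sources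
  arcCount≤2*middles+highs*sources = begin
    arcCount G                  ≡⟨ arcCount≡∑indeg G ⟩
    ∑[ v < n ] indeg G v        ≤⟨ ∑-mono-≤ indeg≤2*[1‥2]+[≥3]*sources ⟩
    ∑[ v < n ] (2 * [1‥2] (indeg G v) + [≥3] (indeg G v) * sources)
      ≡⟨ ∑-distrib-+ (λ v → 2 * [1‥2] (indeg G v)) (λ v → [≥3] (indeg G v) * sources) ⟩
    ∑[ v < n ] (2 * [1‥2] (indeg G v)) + ∑[ v < n ] ([≥3] (indeg G v) * sources)
      ≡⟨ cong₂ _+_ (*-distribˡ-sum 2 ([1‥2] ∘ indeg G)) (*-distribʳ-sum sources ([≥3] ∘ indeg G)) ⟨
    2 * middles + highs * sources ∎
    where open ≤-Reasoning

m≤n⇒4*[m*n]≤[m+n]² : ∀ {m n} → m ≤ n → 4 * (m * n) ≤ (m + n) * (m + n)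
m≤n⇒4*[m*n]≤[m+n]² {m} m≤n with m≤n⇒∃[o]m+o≡n m≤n
... | d , refl = subst (4 * (m * (m + d)) ≤_) (square-expansion m d) (m≤m+n _ (d * d))
  where
  square-expansion : ∀ m d → 4 * (m * (m + d)) + d * d ≡ (m + (m + d)) * (m + (m + d))
  square-expansion = solve-∀

4*[m*n]≤[m+n]² : ∀ m n → 4 * (m * n) ≤ (m + n) * (m + n)
4*[m*n]≤[m+n]² m n with ≤-total m n
... | inj₁ m≤n = m≤n⇒4*[m*n]≤[m+n]² m≤n
... | inj₂ n≤m = subst₂ _≤_ (cong (4 *_) (*-comm n m)) (cong (λ k → k * k) (+-comm n m))
                  (m≤n⇒4*[m*n]≤[m+n]² n≤m)

-- (s + r + t)² = (s + t)² + r (2(s + t) + r), and AM-GM bounds the first term by 4st.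
[2r+ts]*4≤[s+r+t]² : ∀ s r t → 8 ≤ s + r + t → (2 * r + t * s) * 4 ≤ (s + r + t) * (s + r + t)
[2r+ts]*4≤[s+r+t]² s r t 8≤n = begin
  (2 * r + t * s) * 4                       ≡⟨ regroup s r t ⟩
  4 * (s * t) + r * 8
    ≤⟨ +-mono-≤ (4*[m*n]≤[m+n]² s t) (*-monoʳ-≤ r (≤-trans 8≤n (m≤m+n _ (s + t)))) ⟩
  (s + t) * (s + t) + r * (s + r + t + (s + t)) ≡⟨ expand s r t ⟩
  (s + r + t) * (s + r + t)                 ∎
  where
  open ≤-Reasoning
  regroup : ∀ s r t → (2 * r + t * s) * 4 ≡ 4 * (s * t) + r * 8
  regroup = solve-∀
  expand : ∀ s r t → (s + t) * (s + t) + r * (s + r + t + (s + t)) ≡ (s + r + t) * (s + r + t)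
  expand = solve-∀

m*n≤o⇒m≤o/n : ∀ {m o} n .{{_ : NonZero n}} → m * n ≤ o → m ≤ o / n
m*n≤o⇒m≤o/n {m} n m*n≤o = subst (_≤ _) (m*n/n≡m m n) (/-monoˡ-≤ n m*n≤o)

F-free⇒arcCount≤quarterSq : ∀ {n} → 8 ≤ n → (G : Digraph n) → IsOriented G → ¬ F ⊆ᵍ G →
                            arcCount G ≤ quarterSq n
F-free⇒arcCount≤quarterSq {n} 8≤n G ori F⊈G = m*n≤o⇒m≤o/n 4 (begin
  arcCount G * 4
    ≤⟨ *-monoˡ-≤ 4 (arcCount≤2*middles+highs*sources ori F⊈G) ⟩
  (2 * middles + highs * sources) * 4
    ≤⟨ [2r+ts]*4≤[s+r+t]² sources middles highs (subst (8 ≤_) n≡ 8≤n) ⟩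
  (sources + middles + highs) * (sources + middles + highs)
    ≡⟨ cong (λ k → k * k) n≡ ⟨
  n * n ∎)
  where
  open DegreeClasses G
  open ≤-Reasoning
  n≡ : n ≡ sources + middles + highs
  n≡ = n≡sources+middles+highs

bipartite : ∀ {n} → (Fin n → Bool) → Digraph n
bipartite A u v = A u ∧ not (A v)

bipartite-oriented : ∀ {n} (A : Fin n → Bool) → IsOriented (bipartite A)
bipartite-oriented A = record
  { noLoop = Bool.∧-inverseʳ ∘ A
  ; noOpposite = λ u v → reverse (A u) (A v)
  }
  where
  reverse : ∀ a b → a ∧ not b ≡ true → b ∧ not a ≡ false
  reverse true b _ = Bool.∧-zeroʳ b

F⊈bipartite : ∀ {n} (A : Fin n → Bool) → ¬ F ⊆ᵍ bipartite A
F⊈bipartite A (φ , _ , arcs) =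
  no-path (A (φ 0F)) (A (φ 1F)) (A (φ 2F)) (arcs 0F 1F refl) (arcs 1F 2F refl)
  where
  no-path : ∀ a b c → a ∧ not b ≡ true → b ∧ not c ≡ true → ⊥
  no-path true false _ _ ()

arcCount-bipartite : ∀ {n} (A : Fin n → Bool) →
  arcCount (bipartite A) ≡ ∑[ u < n ] ⟦ A u ⟧ * ∑[ v < n ] ⟦ not (A v) ⟧
arcCount-bipartite {n} A = begin
  arcCount (bipartite A)
    ≡⟨ arcCount≡∑∑ (bipartite A) ⟩
  ∑[ u < n ] ∑[ v < n ] ⟦ A u ∧ not (A v) ⟧
    ≡⟨ sum-cong-≗ (λ u → sum-cong-≗ (⟦∧⟧≡* (A u) ∘ not ∘ A)) ⟩
  ∑[ u < n ] ∑[ v < n ] (⟦ A u ⟧ * ⟦ not (A v) ⟧)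
    ≡⟨ sum-cong-≗ (λ u → *-distribˡ-sum ⟦ A u ⟧ (⟦_⟧ ∘ not ∘ A)) ⟨
  ∑[ u < n ] (⟦ A u ⟧ * ∑[ v < n ] ⟦ not (A v) ⟧)
    ≡⟨ *-distribʳ-sum _ (⟦_⟧ ∘ A) ⟨
  ∑[ u < n ] ⟦ A u ⟧ * ∑[ v < n ] ⟦ not (A v) ⟧ ∎
  where open ≡-Reasoning

⌈n/2⌉≡⌊n/2⌋⊎1+⌊n/2⌋ : ∀ n → ⌈ n /2⌉ ≡ ⌊ n /2⌋ ⊎ ⌈ n /2⌉ ≡ suc ⌊ n /2⌋
⌈n/2⌉≡⌊n/2⌋⊎1+⌊n/2⌋ 0 = inj₁ refl
⌈n/2⌉≡⌊n/2⌋⊎1+⌊n/2⌋ 1 = inj₂ refl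
⌈n/2⌉≡⌊n/2⌋⊎1+⌊n/2⌋ (suc (suc n)) = Sum.map (cong suc) (cong suc) (⌈n/2⌉≡⌊n/2⌋⊎1+⌊n/2⌋ n)

k*j≡quarterSq[k+j] : ∀ {k j} → j ≡ k ⊎ j ≡ suc k → k * j ≡ quarterSq (k + j)
k*j≡quarterSq[k+j] {k} (inj₁ refl) = sym (begin
  (k + k) * (k + k) / 4   ≡⟨ cong (_/ 4) (even-square k) ⟩
  k * k * 4 / 4           ≡⟨ m*n/n≡m (k * k) 4 ⟩
  k * k                   ∎)
  where
  open ≡-Reasoning
  even-square : ∀ k → (k + k) * (k + k) ≡ k * k * 4
  even-square = solve-∀
k*j≡quarterSq[k+j] {k} (inj₂ refl) = sym (begin
  (k + suc k) * (k + suc k) / 4    ≡⟨ cong (_/ 4) (odd-square k) ⟩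
  (1 + k * suc k * 4) / 4          ≡⟨ +-distrib-/-∣ʳ 1 {d = 4} (n∣m*n (k * suc k)) ⟩
  1 / 4 + k * suc k * 4 / 4        ≡⟨ m*n/n≡m (k * suc k) 4 ⟩
  k * suc k                        ∎)
  where
  open ≡-Reasoning
  odd-square : ∀ k → (k + suc k) * (k + suc k) ≡ 1 + k * suc k * 4
  odd-square = solve-∀

⌊n/2⌋*⌈n/2⌉≡quarterSq : ∀ n → ⌊ n /2⌋ * ⌈ n /2⌉ ≡ quarterSq n
⌊n/2⌋*⌈n/2⌉≡quarterSq n =
  trans (k*j≡quarterSq[k+j] (⌈n/2⌉≡⌊n/2⌋⊎1+⌊n/2⌋ n)) (cong quarterSq (⌊n/2⌋+⌈n/2⌉≡n n))

∃F-free-with-quarterSq-arcs : ∀ n →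
  Σ (Digraph n) λ G → IsOriented G × ¬ F ⊆ᵍ G × arcCount G ≡ quarterSq n
∃F-free-with-quarterSq-arcs n = bipartite A , bipartite-oriented A , F⊈bipartite A , (begin
  arcCount (bipartite A)                          ≡⟨ arcCount-bipartite A ⟩
  ∑[ u < n ] ⟦ A u ⟧ * ∑[ v < n ] ⟦ not (A v) ⟧   ≡⟨ cong₂ _*_ |A| |Aᶜ| ⟩
  ⌊ n /2⌋ * ⌈ n /2⌉                               ≡⟨ ⌊n/2⌋*⌈n/2⌉≡quarterSq n ⟩
  quarterSq n                                     ∎)
  where
  open ≡-Reasoning
  A : Fin n → Bool
  A u = toℕ u <ᵇ ⌊ n /2⌋
  |A| : ∑[ u < n ] ⟦ A u ⟧ ≡ ⌊ n /2⌋
  |A| = ∑-⟦<ᵇ⟧≡k (⌊n/2⌋≤n n)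
  |Aᶜ| : ∑[ v < n ] ⟦ not (A v) ⟧ ≡ ⌈ n /2⌉
  |Aᶜ| = +-cancelˡ-≡ ⌊ n /2⌋ _ ⌈ n /2⌉ (begin
    ⌊ n /2⌋ + ∑[ v < n ] ⟦ not (A v) ⟧              ≡⟨ cong (_+ ∑[ v < n ] ⟦ not (A v) ⟧) |A| ⟨
    ∑[ u < n ] ⟦ A u ⟧ + ∑[ v < n ] ⟦ not (A v) ⟧   ≡⟨ ∑⟦p⟧+∑⟦not-p⟧≡n A ⟩
    n                                               ≡⟨ ⌊n/2⌋+⌈n/2⌉≡n n ⟨
    ⌊ n /2⌋ + ⌈ n /2⌉                               ∎)

proposition2p3 : Σ ℕ λ N → ∀ n → n ≥ N → ExOriIs n F (quarterSq n)
proposition2p3 = 8 , λ n 8≤n → ∃F-free-with-quarterSq-arcs n , F-free⇒arcCount≤quarterSq 8≤n
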